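{- Let $G$ be a graph of order $n$ and let $D_n$ be a maximal Diophantine graph of order $n$. If $G$ is Diophantine, then $\delta(G)\le\delta(D_n)$.
   Context: All graphs are finite, simple and undirected. A graph $G$ with $n$ vertices is Diophantine if there is a bijection $f:V(G)\to\{1,\dots,n\}$ such that $\gcd(f(u),f(v))\mid n$ for every edge $uv$. A maximal Diophantine graph $D_n$ of order $n$ is a Diophantine graph of order $n$ such that adding any new edge yields a non-Diophantine graph. $\delta(H)$ is the minimum degree of a graph $H$. -}

module Defs where

open import Data.Nat using (ℕ; zero; suc; _+_; _⊓_)
open import Data.Nat.GCD using (gcd)
open import Data.Nat.Divisibility using (_∣_)
open import Data.Bool using (Bool; true; false; _∨_; if_then_else_)
open import Data.Fin using (Fin; toℕ; _≟_)
open import Data.Vec.Functional using (foldr)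
open import Data.Fin.Permutation using (Permutation′; _⟨$⟩ʳ_)
open import Relation.Binary.PropositionalEquality using (_≡_; _≢_)
open import Relation.Nullary using (¬_; does)
open import Data.Product using (Σ; _×_)
open import Data.Sum using (_⊎_)
open import Function.Bundles using (_⇔_)
import Data.Fin as Fin

record Graph (n : ℕ) : Set where
  field
    adj   : Fin n → Fin n → Bool
    sym   : ∀ u v → adj u v ≡ adj v u
    irrefl : ∀ v → adj v v ≡ false
open Graph public

Edge : ∀ {n} → Graph n → Fin n → Fin n → Set
Edge G u v = adj G u v ≡ true

-- A labelling is a bijection V(G) → {1,…,n}; we encode it as a permutation
-- σ of Fin n and use the label toℕ (σ v) + 1.
label : ∀ {n} → Permutation′ n → Fin n → ℕ
label σ v = suc (toℕ (σ ⟨$⟩ʳ v))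

Diophantine : ∀ {n} → Graph n → Set
Diophantine {n} G =
  Σ (Permutation′ n) λ σ → ∀ u v → Edge G u v → gcd (label σ u) (label σ v) ∣ n

AddsEdge : ∀ {n} → Graph n → Graph n → Fin n → Fin n → Set
AddsEdge G H u v =
  (u ≢ v) × (¬ Edge G u v) ×
  (∀ x y → Edge H x y ⇔ (Edge G x y ⊎ ((x ≡ u × y ≡ v) ⊎ (x ≡ v × y ≡ u))))

MaximalDiophantine : ∀ {n} → Graph n → Set
MaximalDiophantine {n} D =
  Diophantine D ×
  (∀ (H : Graph n) (u v : Fin n) → AddsEdge D H u v → ¬ Diophantine H)

degree : ∀ {n} → Graph n → Fin n → ℕ
degree G v = count (λ w → adj G v w)
  where
  count : ∀ {m} → (Fin m → Bool) → ℕ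
  count {m} p = foldr (λ b acc → (if b then 1 else 0) + acc) 0 p

δ : ∀ {n} → Graph (suc n) → ℕ
δ {n} G = foldr _⊓_ (degree G Fin.zero) (degree G)

{-# OPTIONS --safe #-}
module Submission where

-- A maximal Diophantine graph D with Diophantine labelling τ contains every edge uv
-- with gcd (τ u) (τ v) ∣ n: otherwise τ would still be a Diophantine labelling of
-- D + uv. So if σ is a Diophantine labelling of G, the bijection τ⁻¹ ∘ σ maps every
-- edge of G to an edge of D, and each vertex of D has at least the degree of its
-- preimage in G.

open import Defs hiding (sym)
open import Data.Bool using (Bool; true; false; _∨_; if_then_else_)
open import Data.Bool.Properties using () renaming (_≟_ to _≟ᵇ_)
open import Data.Fin using (Fin; toℕ; _≟_)
import Data.Fin as Fin
open import Data.Fin.Permutation using (Permutation′; _⟨$⟩ʳ_; _⟨$⟩ˡ_; inverseʳ; _∘ₚ_; flip)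
open import Data.Nat using (ℕ; zero; suc; _≤_; _+_; _⊓_; z≤n)
open import Data.Nat.Divisibility using (_∣_)
open import Data.Nat.GCD using (gcd; gcd-comm)
open import Data.Nat.Properties using (≤-refl; ≤-trans; +-mono-≤; ⊓-glb; m⊓n≤m; m⊓n≤n; +-0-commutativeMonoid)
open import Data.Product using (_×_; _,_)
import Data.Product as Product
open import Data.Sum using (_⊎_; inj₁; inj₂)
import Data.Sum as Sum
open import Data.Sum.Function.Propositional using (_⊎-⇔_)
open import Data.Vec.Functional using (foldr)
open import Function using (_∘_; const)
open import Function.Bundles using (_⇔_; mk⇔; Equivalence; Injection)
open import Function.Construct.Composition using (_⇔-∘_)
open import Function.Construct.Identity using (⇔-id)
open import Function.Properties.Inverse using (↔⇒↣)
open import Relation.Binary.PropositionalEquality using (_≡_; _≢_; refl; sym; trans; cong; cong₂; subst; subst₂)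
open import Relation.Nullary using (¬_; Dec; does; yes; no; contradiction; _×-dec_; _⊎-dec_)
open import Relation.Nullary.Decidable using (dec-false; does-⇔)
open import Algebra.Properties.CommutativeMonoid.Sum +-0-commutativeMonoid using (sum; sum-permute)

bit : Bool → ℕ
bit b = if b then 1 else 0

foldr-count≡sum : ∀ {m} (p : Fin m → Bool) → foldr (λ b acc → bit b + acc) 0 p ≡ sum (bit ∘ p)
foldr-count≡sum {zero} p = refl
foldr-count≡sum {suc m} p = cong (bit (p Fin.zero) +_) (foldr-count≡sum (p ∘ Fin.suc))

degree≡sum : ∀ {n} (G : Graph n) v → degree G v ≡ sum (bit ∘ adj G v)
degree≡sum G v = foldr-count≡sum (adj G v)

sum-mono-≤ : ∀ {m} {f g : Fin m → ℕ} → (∀ i → f i ≤ g i) → sum f ≤ sum g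
sum-mono-≤ {zero} f≤g = z≤n
sum-mono-≤ {suc m} f≤g = +-mono-≤ (f≤g Fin.zero) (sum-mono-≤ (f≤g ∘ Fin.suc))

bit-mono : ∀ {a b} → (a ≡ true → b ≡ true) → bit a ≤ bit b
bit-mono {false} a⇒b = z≤n
bit-mono {true}  a⇒b rewrite a⇒b refl = ≤-refl

foldr-⊓-≤ : ∀ {m} z (f : Fin m → ℕ) i → foldr _⊓_ z f ≤ f i
foldr-⊓-≤ z f Fin.zero    = m⊓n≤m _ _
foldr-⊓-≤ z f (Fin.suc i) = ≤-trans (m⊓n≤n _ _) (foldr-⊓-≤ z (f ∘ Fin.suc) i)

foldr-⊓-glb : ∀ {m x z} (f : Fin m → ℕ) → x ≤ z → (∀ i → x ≤ f i) → x ≤ foldr _⊓_ z f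
foldr-⊓-glb {zero} f x≤z x≤f = x≤z
foldr-⊓-glb {suc m}  f x≤z x≤f = ⊓-glb (x≤f Fin.zero) (foldr-⊓-glb (f ∘ Fin.suc) x≤z (x≤f ∘ Fin.suc))

δ≤degree : ∀ {n} (G : Graph (suc n)) v → δ G ≤ degree G v
δ≤degree G = foldr-⊓-≤ (degree G Fin.zero) (degree G)

δ-glb : ∀ {n x} (G : Graph (suc n)) → (∀ v → x ≤ degree G v) → x ≤ δ G
δ-glb G x≤deg = foldr-⊓-glb (degree G) (x≤deg Fin.zero) x≤deg

EdgePreserving : ∀ {m n} → Graph m → Graph n → (Fin m → Fin n) → Set
EdgePreserving G H f = ∀ x y → Edge G x y → Edge H (f x) (f y)

degree-mono : ∀ {n} (G H : Graph n) (π : Permutation′ n) → EdgePreserving G H (π ⟨$⟩ʳ_) →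
              ∀ x → degree G x ≤ degree H (π ⟨$⟩ʳ x)
degree-mono G H π preserves x = begin
  degree G x                              ≡⟨ degree≡sum G x ⟩
  sum (bit ∘ adj G x)                     ≤⟨ sum-mono-≤ (λ y → bit-mono (preserves x y)) ⟩
  sum (bit ∘ adj H (π ⟨$⟩ʳ x) ∘ (π ⟨$⟩ʳ_)) ≡⟨ sum-permute (bit ∘ adj H (π ⟨$⟩ʳ x)) π ⟨
  sum (bit ∘ adj H (π ⟨$⟩ʳ x))             ≡⟨ degree≡sum H (π ⟨$⟩ʳ x) ⟨
  degree H (π ⟨$⟩ʳ x)                     ∎
  where open Data.Nat.Properties.≤-Reasoning

δ-mono : ∀ {n} (G H : Graph (suc n)) (π : Permutation′ (suc n)) → EdgePreserving G H (π ⟨$⟩ʳ_) →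
         δ G ≤ δ H
δ-mono G H π preserves = δ-glb H λ v →
  ≤-trans (δ≤degree G (π ⟨$⟩ˡ v))
          (subst (λ w → degree G (π ⟨$⟩ˡ v) ≤ degree H w) (inverseʳ π) (degree-mono G H π preserves _))

∨≡true⇔ : ∀ {a b} → a ∨ b ≡ true ⇔ (a ≡ true ⊎ b ≡ true)
∨≡true⇔ {true}  = mk⇔ inj₁ (const refl)
∨≡true⇔ {false} = mk⇔ inj₂ λ { (inj₁ ()) ; (inj₂ b) → b }

does≡true⇔ : ∀ {A : Set} (a? : Dec A) → does a? ≡ true ⇔ A
does≡true⇔ (yes a)  = mk⇔ (const a) (const refl)
does≡true⇔ (no ¬a) = mk⇔ (λ ()) (λ a → contradiction a ¬a)

edge⇒≢ : ∀ {n} (G : Graph n) {x y} → Edge G x y → x ≢ y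
edge⇒≢ G {x} e refl with trans (sym e) (irrefl G x)
... | ()

SameEdge : ∀ {n} → Fin n → Fin n → Fin n → Fin n → Set
SameEdge u v x y = (x ≡ u × y ≡ v) ⊎ (x ≡ v × y ≡ u)

sameEdge? : ∀ {n} (u v x y : Fin n) → Dec (SameEdge u v x y)
sameEdge? u v x y = (x ≟ u ×-dec y ≟ v) ⊎-dec (x ≟ v ×-dec y ≟ u)

SameEdge-flip : ∀ {n} {u v x y : Fin n} → SameEdge u v x y → SameEdge u v y x
SameEdge-flip = Sum.swap ∘ Sum.map Product.swap Product.swap

IsDiophantineLabelling : ∀ {n} → Graph n → Permutation′ n → Set
IsDiophantineLabelling {n} G σ = ∀ u v → Edge G u v → gcd (label σ u) (label σ v) ∣ n

module _ {n} (D : Graph n) {u v : Fin n} (u≢v : u ≢ v) where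

  addEdge : Graph n
  addEdge = record
    { adj    = λ x y → adj D x y ∨ does (sameEdge? u v x y)
    ; sym    = λ x y → cong₂ _∨_ (Graph.sym D x y)
                         (does-⇔ (mk⇔ SameEdge-flip SameEdge-flip) (sameEdge? u v x y) (sameEdge? u v y x))
    ; irrefl = λ x → cong₂ _∨_ (irrefl D x) (dec-false (sameEdge? u v x x) ¬SameEdge-loop)
    }
    where
    ¬SameEdge-loop : ∀ {x} → ¬ SameEdge u v x x
    ¬SameEdge-loop (inj₁ (refl , u≡v)) = u≢v u≡v
    ¬SameEdge-loop (inj₂ (refl , v≡u)) = u≢v (sym v≡u)

  addEdge-edge⇔ : ∀ {x y} → Edge addEdge x y ⇔ (Edge D x y ⊎ SameEdge u v x y)
  addEdge-edge⇔ {x} {y} = (⇔-id _ ⊎-⇔ does≡true⇔ (sameEdge? u v x y)) ⇔-∘ ∨≡true⇔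

  addEdge-adds : ¬ Edge D u v → AddsEdge D addEdge u v
  addEdge-adds ¬uv = u≢v , ¬uv , λ x y → addEdge-edge⇔

  addEdge-labelling : ∀ τ → IsDiophantineLabelling D τ → gcd (label τ u) (label τ v) ∣ n →
                      IsDiophantineLabelling addEdge τ
  addEdge-labelling τ dτ uv∣n x y e with Equivalence.to (addEdge-edge⇔ {x} {y}) e
  ... | inj₁ e′                   = dτ x y e′
  ... | inj₂ (inj₁ (refl , refl)) = uv∣n
  ... | inj₂ (inj₂ (refl , refl)) = subst (_∣ n) (gcd-comm (label τ u) (label τ v)) uv∣n

maximal-saturated : ∀ {n} (D : Graph n) (τ : Permutation′ n) {u v} →
                    MaximalDiophantine D → IsDiophantineLabelling D τ →
                    u ≢ v → gcd (label τ u) (label τ v) ∣ n → Edge D u v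
maximal-saturated D τ {u} {v} (_ , maximal) dτ u≢v uv∣n with adj D u v ≟ᵇ true
... | yes uv  = uv
... | no ¬uv = contradiction (τ , addEdge-labelling D u≢v τ dτ uv∣n)
                             (maximal (addEdge D u≢v) u v (addEdge-adds D u≢v ¬uv))

label-relabel : ∀ {n} (σ τ : Permutation′ n) x → label τ ((σ ∘ₚ flip τ) ⟨$⟩ʳ x) ≡ label σ x
label-relabel σ τ x = cong (suc ∘ toℕ) (inverseʳ τ)

relabel-edgePreserving : ∀ {n} (G D : Graph n) (σ τ : Permutation′ n) → MaximalDiophantine D →
                         IsDiophantineLabelling D τ → IsDiophantineLabelling G σ →
                         EdgePreserving G D ((σ ∘ₚ flip τ) ⟨$⟩ʳ_)
relabel-edgePreserving {n} G D σ τ md dτ dσ x y e =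
  maximal-saturated D τ md dτ (edge⇒≢ G e ∘ Injection.injective (↔⇒↣ (σ ∘ₚ flip τ)))
    (subst₂ (λ a b → gcd a b ∣ n) (sym (label-relabel σ τ x)) (sym (label-relabel σ τ y)) (dσ x y e))

corollary3p15 : ∀ {n : ℕ} (G D : Graph (suc n)) →
    MaximalDiophantine D → Diophantine G → δ G ≤ δ D
corollary3p15 G D md@((τ , dτ) , _) (σ , dσ) =
  δ-mono G D (σ ∘ₚ flip τ) (relabel-edgePreserving G D σ τ md dτ dσ)
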